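{- Let $B$ be a bicyclic graph of order $n$ and maximum degree $\Delta$ such that $n \equiv 0 \pmod{\Delta-1}$. Then $$F(B)\le (\Delta^2+\Delta+2)\,n+26.$$
   Context: All graphs are finite and simple. For a graph $G$ with vertex set $V$ and edge set $E$, the order is $n=|V|$ and the size is $m=|E|$; $G$ is called bicyclic if $m=n+1$. The degree of a vertex $v$ is $d(v)$, and $\Delta$ denotes the maximum degree of $G$. The forgotten topological index (F-index) of $G$ is $F(G)=\sum_{uv\in E}\left(d(u)^2+d(v)^2\right)=\sum_{v\in V} d(v)^3$. -}

module Defs where

open import Data.Nat using (ℕ; zero; suc; _+_; _*_; _^_; _<_; _⊔_)
open import Data.Bool using (Bool; true; false; if_then_else_)
open import Data.Fin using (Fin; toℕ)
open import Data.Nat.ListAction using (sum)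
open import Data.List using (List; map; length; filter; allFin; concatMap)
open import Data.Product using (_×_; _,_)
open import Relation.Binary.PropositionalEquality using (_≡_)
open import Relation.Nullary using (¬_)
open import Data.Nat using (_<?_)

record Graph (n : ℕ) : Set where
  field
    adj       : Fin n → Fin n → Bool
    symmetric : ∀ u v → adj u v ≡ adj v u
    irreflex  : ∀ v → adj v v ≡ false
open Graph public

order : ∀ {n} → Graph n → ℕ
order {n} _ = n

degree : ∀ {n} → Graph n → Fin n → ℕ
degree G v = length (filter (λ u → adj G v u Data.Bool.≟ true) (allFin _))
  where import Data.Bool

size : ∀ {n} → Graph n → ℕ
size {n} G = length (filter (λ p → isEdge p Data.Bool.≟ true)
                       (concatMap (λ u → map (λ v → (u , v)) (allFin n)) (allFin n)))
  where
  import Data.Bool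
  isEdge : Fin n × Fin n → Bool
  isEdge (u , v) = if Relation.Nullary.Decidable.⌊ toℕ u <? toℕ v ⌋ then adj G u v else false
    where import Relation.Nullary.Decidable

-- maximum degree Δ (0 for the empty graph)
maxDegree : ∀ {n} → Graph n → ℕ
maxDegree {n} G = Data.List.foldr _⊔_ 0 (map (degree G) (allFin n))

forgotten : ∀ {n} → Graph n → ℕ
forgotten {n} G = sum (map (λ v → degree G v ^ 3) (allFin n))

data Reach {n} (G : Graph n) : Fin n → Fin n → Set where
  here  : ∀ {v} → Reach G v v
  step  : ∀ {u w v} → adj G u w ≡ true → Reach G w v → Reach G u v

Connected : ∀ {n} → Graph n → Set
Connected G = ∀ u v → Reach G u v

Bicyclic : ∀ {n} → Graph n → Set
Bicyclic {n} G = Connected G × size G ≡ n + 1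

-- Write d(v) = 1 + r(v) and t = Δ − 1, so that 0 ≤ r(v) ≤ t. The handshake lemma and m = n + 1
-- give Σ r(v) = n + 2 = q t + 2 where n = q t, while F = n + Σ g(r(v)) for g(r) = (1 + r)³ − 1 (excessCube).
-- Since g is convex with g(0) = 0, two values a, b ≤ t with a + b = t + c satisfy
-- g(a) + g(b) ≤ g(t) + g(c); absorbing the r(v) one at a time therefore gives
-- Σ g(r(v)) ≤ Q g(t) + g(S), where Q t + S = Σ r(v) and S < t. By uniqueness of division this
-- is q g(t) + g(2) = q g(t) + 26 when t ≥ 3, and (q + 2) g(1), (q + 1) g(2) when t = 1, 2,
-- both at most q g(t) + 26. Finally n + q g(t) = q ((t + 1)³ + t − 1) = (Δ² + Δ + 2) n.
module Submission where

open import Defs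
open import Data.Nat using (ℕ; zero; suc; z<s; _+_; _*_; _^_; _∸_; _≤_; _<_; _<?_; z≤n; s≤s; pred; >-nonZero)
open import Data.Nat.Divisibility using (_∣_; divides)
open import Data.Nat.Properties hiding (_≟_)
open import Algebra.Properties.CommutativeSemigroup +-commutativeSemigroup using (x∙yz≈y∙xz; xy∙z≈z∙yx)
open import Data.Nat.ListAction using (sum)
open import Data.Nat.ListAction.Properties using (sum-++)
open import Data.Nat.Tactic.RingSolver using (solve-∀)
open import Data.Bool using (Bool; true; false; if_then_else_; _≟_)
open import Data.Fin using (Fin; toℕ) renaming (zero to fzero; suc to fsuc)
open import Data.Fin.Properties using (toℕ-injective)
open import Data.List using (List; []; _∷_; _++_; map; length; filter; tabulate; allFin; concatMap)
open import Data.List.Properties using (map-++; map-∘; foldr-preservesᵒ)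
import Data.List.Relation.Unary.Any as Any
open import Data.List.Membership.Propositional.Properties using (∈-allFin; ∈-map⁺)
open import Data.Product using (∃₂; _×_; _,_)
open import Data.Sum using ([_,_]; inj₂)
open import Data.Empty using (⊥-elim)
open import Function using (id; _∘_)
open import Relation.Binary.PropositionalEquality hiding ([_])
open import Relation.Nullary using (yes; no)
open import Relation.Nullary.Decidable using (⌊_⌋)
open import Algebra.Properties.CommutativeMonoid.Sum +-0-commutativeMonoid
  using (sum-syntax; ∑-distrib-+; ∑-comm; sum-cong-≗)

indicator : Bool → ℕ
indicator true  = 1
indicator false = 0

module _ {A : Set} where

  length-filter-true : (b : A → Bool) (xs : List A) →
                       length (filter (λ x → b x ≟ true) xs) ≡ sum (map (indicator ∘ b) xs)
  length-filter-true b [] = refl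
  length-filter-true b (x ∷ xs) with b x
  ... | true  = cong suc (length-filter-true b xs)
  ... | false = length-filter-true b xs

  sum-map-tabulate : ∀ {n} (f : A → ℕ) (g : Fin n → A) →
                     sum (map f (tabulate g)) ≡ ∑[ i < n ] f (g i)
  sum-map-tabulate {zero}  f g = refl
  sum-map-tabulate {suc n} f g = cong (f (g fzero) +_) (sum-map-tabulate f (g ∘ fsuc))

  sum-map-concatMap : ∀ {B : Set} (f : B → ℕ) (g : A → List B) (xs : List A) →
                      sum (map f (concatMap g xs)) ≡ sum (map (λ x → sum (map f (g x))) xs)
  sum-map-concatMap f g [] = refl
  sum-map-concatMap f g (x ∷ xs) = begin
    sum (map f (g x ++ concatMap g xs))
      ≡⟨ cong sum (map-++ f (g x) _) ⟩
    sum (map f (g x) ++ map f (concatMap g xs))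
      ≡⟨ sum-++ (map f (g x)) _ ⟩
    sum (map f (g x)) + sum (map f (concatMap g xs))
      ≡⟨ cong (sum (map f (g x)) +_) (sum-map-concatMap f g xs) ⟩
    sum (map f (g x)) + sum (map (λ y → sum (map f (g y))) xs) ∎
    where open ≡-Reasoning

∑-suc : ∀ {n} (f : Fin n → ℕ) → ∑[ i < n ] suc (f i) ≡ n + ∑[ i < n ] f i
∑-suc {zero}  f = refl
∑-suc {suc n} f = cong suc (trans (cong (f fzero +_) (∑-suc (f ∘ fsuc))) (x∙yz≈y∙xz (f fzero) n _))

term≤∑ : ∀ {n} (f : Fin n → ℕ) i → f i ≤ ∑[ j < n ] f j
term≤∑ f fzero    = m≤m+n _ _
term≤∑ f (fsuc i) = ≤-trans (term≤∑ (f ∘ fsuc) i) (m≤n+m _ (f fzero))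

forwardAdj : ∀ {n} → Graph n → Fin n → Fin n → Bool
forwardAdj G u v = if ⌊ toℕ u <? toℕ v ⌋ then adj G u v else false

module _ {n} (G : Graph n) where

  degree-∑ : ∀ v → degree G v ≡ ∑[ u < n ] indicator (adj G v u)
  degree-∑ v = trans (length-filter-true (adj G v) (allFin n)) (sum-map-tabulate (indicator ∘ adj G v) id)

  size-∑ : size G ≡ ∑[ u < n ] ∑[ v < n ] indicator (forwardAdj G u v)
  size-∑ = begin
    size G
      ≡⟨ length-filter-true (λ (u , v) → forwardAdj G u v) (concatMap pairs (allFin n)) ⟩
    sum (map edge (concatMap pairs (allFin n)))
      ≡⟨ sum-map-concatMap edge pairs (allFin n) ⟩
    sum (map (λ u → sum (map edge (pairs u))) (allFin n))
      ≡⟨ sum-map-tabulate (λ u → sum (map edge (pairs u))) id ⟩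
    ∑[ u < n ] sum (map edge (pairs u))
      ≡⟨ sum-cong-≗ (λ u → trans (cong sum (sym (map-∘ (allFin n)))) (sum-map-tabulate (edge ∘ (u ,_)) id)) ⟩
    ∑[ u < n ] ∑[ v < n ] indicator (forwardAdj G u v) ∎
    where
    open ≡-Reasoning
    pairs : Fin n → List (Fin n × Fin n)
    pairs u = map (u ,_) (allFin n)
    edge : Fin n × Fin n → ℕ
    edge (u , v) = indicator (forwardAdj G u v)

  indicator-adj : ∀ u v → indicator (adj G u v) ≡ indicator (forwardAdj G u v) + indicator (forwardAdj G v u)
  indicator-adj u v with toℕ u <? toℕ v | toℕ v <? toℕ u
  ... | yes u<v | yes v<u = ⊥-elim (<-asym u<v v<u)
  ... | yes _   | no _    = sym (+-identityʳ _)
  ... | no _    | yes _   = cong indicator (symmetric G u v)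
  ... | no u≮v  | no v≮u rewrite toℕ-injective (≤-antisym (≮⇒≥ v≮u) (≮⇒≥ u≮v)) = cong indicator (irreflex G v)

  handshake : ∑[ v < n ] degree G v ≡ size G + size G
  handshake = begin
    ∑[ v < n ] degree G v
      ≡⟨ sum-cong-≗ degree-∑ ⟩
    ∑[ v < n ] ∑[ u < n ] indicator (adj G v u)
      ≡⟨ sum-cong-≗ (λ v → trans (sum-cong-≗ (indicator-adj v)) (∑-distrib-+ (e v) (λ u → e u v))) ⟩
    ∑[ v < n ] (∑[ u < n ] e v u + ∑[ u < n ] e u v)
      ≡⟨ ∑-distrib-+ (λ v → ∑[ u < n ] e v u) (λ v → ∑[ u < n ] e u v) ⟩
    ∑[ v < n ] ∑[ u < n ] e v u + ∑[ v < n ] ∑[ u < n ] e u v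
      ≡⟨ cong (∑[ v < n ] ∑[ u < n ] e v u +_) (∑-comm (λ v u → e u v)) ⟩
    ∑[ v < n ] ∑[ u < n ] e v u + ∑[ u < n ] ∑[ v < n ] e u v
      ≡⟨ cong₂ _+_ size-∑ size-∑ ⟨
    size G + size G ∎
    where
    open ≡-Reasoning
    e : Fin n → Fin n → ℕ
    e u v = indicator (forwardAdj G u v)

  forgotten-∑ : forgotten G ≡ ∑[ v < n ] (degree G v ^ 3)
  forgotten-∑ = sum-map-tabulate (λ v → degree G v ^ 3) id

  degree≤maxDegree : ∀ v → degree G v ≤ maxDegree G
  degree≤maxDegree v = foldr-preservesᵒ
    (λ x y → [ m≤n⇒m≤n⊔o y , m≤n⇒m≤o⊔n x ]) 0 (map (degree G) (allFin n))
    (inj₂ (Any.map ≤-reflexive (∈-map⁺ (degree G) (∈-allFin v))))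

  adj⇒degree-pos : ∀ {v w} → adj G v w ≡ true → 0 < degree G v
  adj⇒degree-pos {v} {w} v~w = begin-strict
    0 <⟨ subst (0 <_) (cong indicator (sym v~w)) z<s ⟩
    indicator (adj G v w) ≤⟨ term≤∑ (indicator ∘ adj G v) w ⟩
    ∑[ u < n ] indicator (adj G v u) ≡⟨ degree-∑ v ⟨
    degree G v ∎
    where open ≤-Reasoning

connected⇒degree-pos : ∀ {m} (G : Graph (2 + m)) → Connected G → ∀ v → 0 < degree G v
connected⇒degree-pos G connected fzero with connected fzero (fsuc fzero)
... | step v~w _ = adj⇒degree-pos G v~w
connected⇒degree-pos G connected (fsuc v) with connected (fsuc v) fzero
... | step v~w _ = adj⇒degree-pos G v~w

excessCube : ℕ → ℕ
excessCube r = r * r * r + 3 * (r * r) + 3 * r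

suc-cube : ∀ r → suc r ^ 3 ≡ suc (excessCube r)
suc-cube r = expand r
  where
  expand : ∀ r → (1 + r) * ((1 + r) * ((1 + r) * 1)) ≡ 1 + (r * r * r + 3 * (r * r) + 3 * r)
  expand = solve-∀

excessCube-exchange : ∀ c x z → excessCube (c + x) + excessCube (c + z) ≤ excessCube (c + z + x) + excessCube c
excessCube-exchange c x z = subst (excessCube (c + x) + excessCube (c + z) ≤_) (sym (identity c x z)) (m≤m+n _ _)
  where
  identity : ∀ c x z →
    let e r = r * r * r + 3 * (r * r) + 3 * r in
    e (c + z + x) + e c ≡ e (c + x) + e (c + z) + 3 * x * z * (2 * c + 2 + x + z)
  identity = solve-∀

excessCube-superadditive : ∀ a b → excessCube a + excessCube b ≤ excessCube (a + b)
excessCube-superadditive a b = subst₂ _≤_ (+-comm (excessCube b) (excessCube a)) (+-identityʳ _) (excessCube-exchange 0 b a)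

excessCube-spread : ∀ {a b t c} → a ≤ t → b ≤ t → a + b ≡ t + c →
                    excessCube a + excessCube b ≤ excessCube t + excessCube c
excessCube-spread {a} {b} {t} {c} a≤t b≤t a+b≡t+c
  with x , refl ← m≤n⇒∃[o]m+o≡n b≤t
  with a≡c+x ← +-cancelʳ-≡ b a (c + x) (trans a+b≡t+c (trans (xy∙z≈z∙yx b x c) (sym (+-assoc c x b))))
  with z , refl ← m≤n⇒∃[o]m+o≡n (+-cancelʳ-≤ x c b (subst (_≤ b + x) a≡c+x a≤t))
  rewrite a≡c+x = excessCube-exchange c x z

BlockBound : ℕ → ℕ → ℕ → Set
BlockBound t s y = ∃₂ λ Q S → S < t × Q * t + S ≡ s × y ≤ Q * excessCube t + excessCube S

blockBound-absorb : ∀ {r S t} → r ≤ t → S < t → BlockBound t (r + S) (excessCube r + excessCube S)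
blockBound-absorb {r} {S} {t} r≤t S<t with r + S <? t
... | yes r+S<t = 0 , r + S , r+S<t , refl , excessCube-superadditive r S
... | no r+S≮t = 1 , S′ , S′<t , 1*t+S′≡r+S , bound
  where
  S′ : ℕ
  S′ = r + S ∸ t
  t+S′≡r+S : t + S′ ≡ r + S
  t+S′≡r+S = m+[n∸m]≡n (≮⇒≥ r+S≮t)
  S′<t : S′ < t
  S′<t = +-cancelˡ-< t S′ t (subst (_< t + t) (sym t+S′≡r+S) (+-mono-≤-< r≤t S<t))
  1*t+S′≡r+S : 1 * t + S′ ≡ r + S
  1*t+S′≡r+S = trans (cong (_+ S′) (*-identityˡ t)) t+S′≡r+S
  bound : excessCube r + excessCube S ≤ 1 * excessCube t + excessCube S′
  bound = subst (λ y → excessCube r + excessCube S ≤ y + excessCube S′) (sym (*-identityˡ (excessCube t)))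
                (excessCube-spread r≤t (<⇒≤ S<t) (sym t+S′≡r+S))

blocks-merge : ∀ k Q t x → (k + Q) * t + x ≡ Q * t + (k * t + x)
blocks-merge = solve-∀

blockBound-∑ : ∀ {n t} → 0 < t → (r : Fin n → ℕ) → (∀ i → r i ≤ t) →
               BlockBound t (∑[ i < n ] r i) (∑[ i < n ] excessCube (r i))
blockBound-∑ {zero}  0<t r r≤t = 0 , 0 , 0<t , refl , z≤n
blockBound-∑ {suc n} {t} 0<t r r≤t
  with Q , S , S<t , QS≡∑ , ∑≤QS ← blockBound-∑ 0<t (r ∘ fsuc) (r≤t ∘ fsuc)
  with k , S′ , S′<t , kS′≡r₀S , r₀S≤kS′ ← blockBound-absorb (r≤t fzero) S<t
  = k + Q , S′ , S′<t , split , bound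
  where
  r₀ = r fzero
  split : (k + Q) * t + S′ ≡ r₀ + ∑[ i < n ] r (fsuc i)
  split = begin
    (k + Q) * t + S′     ≡⟨ blocks-merge k Q t S′ ⟩
    Q * t + (k * t + S′) ≡⟨ cong (Q * t +_) kS′≡r₀S ⟩
    Q * t + (r₀ + S)     ≡⟨ x∙yz≈y∙xz (Q * t) r₀ S ⟩
    r₀ + (Q * t + S)     ≡⟨ cong (r₀ +_) QS≡∑ ⟩
    r₀ + ∑[ i < n ] r (fsuc i) ∎
    where open ≡-Reasoning
  bound : excessCube r₀ + ∑[ i < n ] excessCube (r (fsuc i)) ≤ (k + Q) * excessCube t + excessCube S′
  bound = begin
    excessCube r₀ + ∑[ i < n ] excessCube (r (fsuc i)) ≤⟨ +-monoʳ-≤ (excessCube r₀) ∑≤QS ⟩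
    excessCube r₀ + (Q * excessCube t + excessCube S)  ≡⟨ x∙yz≈y∙xz (excessCube r₀) (Q * excessCube t) _ ⟩
    Q * excessCube t + (excessCube r₀ + excessCube S)  ≤⟨ +-monoʳ-≤ (Q * excessCube t) r₀S≤kS′ ⟩
    Q * excessCube t + (k * excessCube t + excessCube S′) ≡⟨ blocks-merge k Q (excessCube t) (excessCube S′) ⟨
    (k + Q) * excessCube t + excessCube S′ ∎
    where open ≤-Reasoning

divMod-unique : ∀ {Q q S R t} → S < t → R < t → Q * t + S ≡ q * t + R → Q ≡ q × S ≡ R
divMod-unique {zero}  {zero}          _   _   eq = refl , eq
divMod-unique {zero}  {suc q} {t = t} S<t _   eq =
  ⊥-elim (<⇒≱ S<t (subst (t ≤_) (sym eq) (≤-trans (m≤m+n t (q * t)) (m≤m+n _ _))))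
divMod-unique {suc Q} {zero}  {t = t} _   R<t eq =
  ⊥-elim (<⇒≱ R<t (subst (t ≤_) eq (≤-trans (m≤m+n t (Q * t)) (m≤m+n _ _))))
divMod-unique {suc Q} {suc q} {S} {R} {t} S<t R<t eq
  with Q≡q , S≡R ← divMod-unique S<t R<t (+-cancelˡ-≡ t _ _ (trans (sym (+-assoc t (Q * t) S)) (trans eq (+-assoc t (q * t) R))))
  = cong suc Q≡q , S≡R

blockCost-qt+2 : ∀ {Q S t} q → S < t → Q * t + S ≡ q * t + 2 →
                 Q * excessCube t + excessCube S ≤ q * excessCube t + 26
blockCost-qt+2 {t = 0} _ () _
blockCost-qt+2 {Q} {S} {t = 1} q S<1 eq = bound (divMod-unique S<1 z<s (trans eq (two-units q)))
  where
  two-units : ∀ q → q * 1 + 2 ≡ (q + 2) * 1 + 0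
  two-units = solve-∀
  seven : ∀ q → (q + 2) * 7 + 0 ≡ q * 7 + 14
  seven = solve-∀
  bound : Q ≡ q + 2 × S ≡ 0 → Q * 7 + excessCube S ≤ q * 7 + 26
  bound (refl , refl) = ≤-trans (≤-reflexive (seven q)) (+-monoʳ-≤ (q * 7) (m≤m+n 14 12))
blockCost-qt+2 {Q} {S} {t = 2} q S<2 eq = bound (divMod-unique S<2 z<s (trans eq (one-pair q)))
  where
  one-pair : ∀ q → q * 2 + 2 ≡ (q + 1) * 2 + 0
  one-pair = solve-∀
  twenty-six : ∀ q → (q + 1) * 26 + 0 ≡ q * 26 + 26
  twenty-six = solve-∀
  bound : Q ≡ q + 1 × S ≡ 0 → Q * 26 + excessCube S ≤ q * 26 + 26
  bound (refl , refl) = ≤-reflexive (twenty-six q)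
blockCost-qt+2 {Q} {S} {t = suc (suc (suc t))} q S<t eq
  with refl , refl ← divMod-unique {Q} {q} {S} {2} S<t (s≤s (s≤s (s≤s z≤n))) eq
  = ≤-refl

excessCubeSum-bound : ∀ {n t} q → 0 < t → (r : Fin n → ℕ) → (∀ v → r v ≤ t) → ∑[ v < n ] r v ≡ q * t + 2 →
                      ∑[ v < n ] excessCube (r v) ≤ q * excessCube t + 26
excessCubeSum-bound q 0<t r r≤t ∑r≡
  with Q , S , S<t , QS≡∑r , ∑≤QS ← blockBound-∑ 0<t r r≤t
  = ≤-trans ∑≤QS (blockCost-qt+2 {Q} q S<t (trans QS≡∑r ∑r≡))

cubeSum-bound : ∀ {n} Δ q (d : Fin n → ℕ) → (∀ v → 0 < d v) → (∀ v → d v ≤ Δ) →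
                ∑[ v < n ] d v ≡ (n + 1) + (n + 1) → n ≡ q * (Δ ∸ 1) →
                ∑[ v < n ] (d v ^ 3) ≤ (Δ * Δ + Δ + 2) * n + 26
-- For Δ ≤ 1 the divisor Δ ∸ 1 is 0, so n = 0 and the degree sum cannot be 2.
cubeSum-bound 0 q _ _ _ ∑d≡ n≡ with refl ← trans n≡ (*-zeroʳ q) = ⊥-elim (0≢1+n ∑d≡)
cubeSum-bound 1 q _ _ _ ∑d≡ n≡ with refl ← trans n≡ (*-zeroʳ q) = ⊥-elim (0≢1+n ∑d≡)
cubeSum-bound {n} (suc (suc k)) q d 0<d d≤Δ ∑d≡ refl = begin
  ∑[ v < n ] (d v ^ 3)              ≡⟨ sum-cong-≗ (λ v → trans (cong (_^ 3) (d≡suc-r v)) (suc-cube (r v))) ⟩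
  ∑[ v < n ] suc (excessCube (r v)) ≡⟨ ∑-suc (excessCube ∘ r) ⟩
  n + ∑[ v < n ] excessCube (r v)   ≤⟨ +-monoʳ-≤ n (excessCubeSum-bound q z<s r r≤t ∑r≡) ⟩
  n + (q * excessCube t + 26)       ≡⟨ identity q k ⟩
  (Δ * Δ + Δ + 2) * n + 26          ∎
  where
  open ≤-Reasoning
  t = suc k
  Δ = suc t
  r : Fin n → ℕ
  r v = pred (d v)
  d≡suc-r : ∀ v → d v ≡ suc (r v)
  d≡suc-r v = sym (suc-pred (d v) {{>-nonZero (0<d v)}})
  r≤t : ∀ v → r v ≤ t
  r≤t v = ≤-pred (subst (_≤ Δ) (d≡suc-r v) (d≤Δ v))
  double-suc : ∀ n → n + 1 + (n + 1) ≡ n + (n + 2)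
  double-suc = solve-∀
  ∑r≡ : ∑[ v < n ] r v ≡ q * t + 2
  ∑r≡ = +-cancelˡ-≡ n _ _ (begin-equality
    n + ∑[ v < n ] r v       ≡⟨ ∑-suc r ⟨
    ∑[ v < n ] suc (r v)     ≡⟨ sum-cong-≗ d≡suc-r ⟨
    ∑[ v < n ] d v           ≡⟨ ∑d≡ ⟩
    n + 1 + (n + 1)          ≡⟨ double-suc n ⟩
    n + (q * t + 2)          ∎)
  identity : ∀ q k → let t = suc k; e = t * t * t + 3 * (t * t) + 3 * t in
             q * t + (q * e + 26) ≡ (suc t * suc t + suc t + 2) * (q * t) + 26
  identity = solve-∀

mainTheorem1 : ∀ {n} (B : Graph n) → Bicyclic B →
    (maxDegree B ∸ 1) ∣ n →
    forgotten B ≤ (maxDegree B * maxDegree B + maxDegree B + 2) * n + 26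
mainTheorem1 {0} B (_ , ()) _
mainTheorem1 {1} B (_ , ()) _
mainTheorem1 {suc (suc m)} B (connected , size≡n+1) (divides q n≡q*t) =
  ≤-trans (≤-reflexive (forgotten-∑ B))
    (cubeSum-bound (maxDegree B) q (degree B)
      (connected⇒degree-pos B connected)
      (degree≤maxDegree B)
      (trans (handshake B) (cong₂ _+_ size≡n+1 size≡n+1))
      n≡q*t)
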